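{- For every integer $n\ge 0$ and every $\alpha\in(0,1)$, $$\Big(\lambda+\frac1\alpha-2\Big)\phi(B_n)=\phi(P_{n+1})+\frac{(1-\alpha)^2}{\alpha}\,\phi(P_n)$$ as polynomials in $\lambda$.
   Context: For a graph $G$ with degree matrix $D(G)$ and adjacency matrix $A(G)$, and $\alpha\in[0,1]$, let $A_\alpha(G)=\alpha D(G)+(1-\alpha)A(G)$. For a graph $G$ let $\phi(G)=\det(\lambda I-A_\alpha(G))$, and for a square matrix $M$ let $\phi(M)=\det(\lambda I-M)$. Let $P_m$ be the path with vertices $u_1,\dots,u_m$ in order. For $n\ge1$, $B_n$ is the $n\times n$ principal submatrix of $A_\alpha(P_{n+1})$ obtained by deleting the row and column of the end vertex $u_1$. By convention, for $\alpha\in[0,1)$, $\phi(P_0)=\frac{1-2\alpha}{(1-\alpha)^2}$ and $\phi(B_0)=1$. -}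

module Defs where

open import Level using (Level)
open import Data.Nat using (ℕ; zero; suc; _≡ᵇ_) renaming (_+_ to _+ℕ_)
open import Data.Fin using (Fin; zero; suc; toℕ; punchIn)
open import Data.Bool using (Bool; true; false; if_then_else_; _∨_)
open import Algebra.Bundles using (CommutativeRing)

module WithRing {c ℓ : Level} (R : CommutativeRing c ℓ) where
  open CommutativeRing R using (Carrier; _+_; _*_; -_; 0#; 1#)

  Matrix : ℕ → Set c
  Matrix n = Fin n → Fin n → Carrier

  sumFin : (n : ℕ) → (Fin n → Carrier) → Carrier
  sumFin zero    f = 0#
  sumFin (suc n) f = f zero + sumFin n (λ j → f (suc j))

  sign : ℕ → Carrier
  sign zero    = 1#
  sign (suc k) = - sign k

  minor : {n : ℕ} → Matrix (suc n) → Fin (suc n) → Matrix n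
  minor M j r s = M (suc r) (punchIn j s)

  det : (n : ℕ) → Matrix n → Carrier
  det zero    M = 1#
  det (suc n) M = sumFin (suc n) (λ j → (sign (toℕ j) * M zero j) * det n (minor M j))

  idMat : (n : ℕ) → Matrix n
  idMat n i j = if toℕ i ≡ᵇ toℕ j then 1# else 0#

  -- φ(M) = det(λI - M), evaluated at λ = x
  charPoly : (n : ℕ) → Matrix n → Carrier → Carrier
  charPoly n M x = det n (λ i j → x * idMat n i j + - M i j)

  -- adjacency of the path P_m on vertices u_1..u_m (here Fin m, 0-based):
  -- u_i ~ u_j iff |i - j| = 1
  pathAdj : (m : ℕ) → Fin m → Fin m → Bool
  pathAdj m i j = ((toℕ i +ℕ 1) ≡ᵇ toℕ j) ∨ ((toℕ j +ℕ 1) ≡ᵇ toℕ i)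

  A : (m : ℕ) → Matrix m
  A m i j = if pathAdj m i j then 1# else 0#

  D : (m : ℕ) → Matrix m
  D m i j = if toℕ i ≡ᵇ toℕ j then sumFin m (λ k → A m i k) else 0#

  Aα : Carrier → (m : ℕ) → Matrix m
  Aα α m i j = α * D m i j + (1# + - α) * A m i j

  -- B_n: delete row and column of the end vertex u_1 from A_α(P_{n+1})
  B : Carrier → (n : ℕ) → Matrix n
  B α n i j = Aα α (suc n) (suc i) (suc j)

  -- φ(B_n) at λ = x  (φ(B_0) = 1, which is also det of the empty matrix)
  φB : Carrier → ℕ → Carrier → Carrier
  φB α n x = charPoly n (B α n) x

  -- φ(P_m) at λ = x, with the convention φ(P_0) = (1 - 2α)/(1 - α)^2,
  -- where β is an inverse of (1 - α)
  φP : (α β : Carrier) → ℕ → Carrier → Carrier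
  φP α β zero    x = (1# + - (α + α)) * (β * β)
  φP α β (suc m) x = charPoly (suc m) (Aα α (suc m)) x

module Submission where

open import Defs
open import Level using (Level)
open import Algebra.Bundles using (CommutativeRing)
open import Algebra.Solver.Ring.AlmostCommutativeRing using (_-Raw-AlmostCommutative⟶_; fromCommutativeRing)
open import Data.Bool using (true; false; if_then_else_)
open import Data.Fin using (Fin; zero; suc; toℕ; punchIn)
open import Data.Integer as ℤ using (ℤ; +_; -[1+_]; _⊖_; ∣_∣; _◃_)
import Data.Integer.Properties as ℤ
open import Data.Maybe using (Maybe; just; nothing)
open import Data.Nat as ℕ using (ℕ; zero; suc; _≡ᵇ_)
import Data.Nat.Properties as ℕ
open import Data.Sign as Sign using (Sign)
open import Relation.Nullary using (yes; no)
import Relation.Binary.PropositionalEquality as ≡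

-- The matrices λI - A_α(P_{n+1}) and λI - B_{n+1} agree except in the corner entry, which is larger by α
-- in the former (u₁ has one neighbour fewer than u₂), and the corner minor of both is λI - B_n; expanding
-- along the first row gives φ(P_{n+1}) = φ(B_{n+1}) + α φ(B_n). As λI - B_n is tridiagonal,
-- φ(B_{n+2}) = (λ - 2α) φ(B_{n+1}) - (1 - α)² φ(B_n). Substituting both into the right-hand side leaves
-- (λ + 1/α - 2) φ(B_n) once α α⁻¹ = 1 is used; for n = 0 it is a direct computation.

-- The standard library's ring solver needs coefficients with decidable equality mapped into the ring;
-- ℤ maps into every commutative ring.
module IntegerCoefficients {r ℓ : Level} (R : CommutativeRing r ℓ) where
  open CommutativeRing R
  open import Relation.Binary.Reasoning.Setoid setoid
  open import Algebra.Properties.Ring ring using (-‿distribˡ-*; -‿involutive; -0#≈0#)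
  open import Algebra.Properties.AbelianGroup +-abelianGroup using (⁻¹-∙-comm)
  open import Algebra.Properties.CommutativeSemigroup *-commutativeSemigroup using () renaming (interchange to *-interchange)
  open import Algebra.Properties.CommutativeSemigroup +-commutativeSemigroup using () renaming (interchange to +-interchange)
  open import Algebra.Properties.Semiring.Mult.TCOptimised semiring using (_×_; 1+×; ×-homo-+; ×1-homo-*)

  private
    ⟦_⟧ℤ : ℤ → Carrier
    ⟦ + n      ⟧ℤ = n × 1#
    ⟦ -[1+ n ] ⟧ℤ = - (suc n × 1#)

    ⟦_⟧ₛ : Sign → Carrier
    ⟦ Sign.+ ⟧ₛ = 1#
    ⟦ Sign.- ⟧ₛ = - 1#

    ⟦⟧ₛ-homo-* : ∀ s t → ⟦ s Sign.* t ⟧ₛ ≈ ⟦ s ⟧ₛ * ⟦ t ⟧ₛ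
    ⟦⟧ₛ-homo-* Sign.+ t      = sym (*-identityˡ _)
    ⟦⟧ₛ-homo-* Sign.- Sign.+ = sym (*-identityʳ _)
    ⟦⟧ₛ-homo-* Sign.- Sign.- = begin
      1#              ≈⟨ -‿involutive 1# ⟨
      - - 1#          ≈⟨ -‿cong (*-identityˡ (- 1#)) ⟨
      - (1# * - 1#)   ≈⟨ -‿distribˡ-* 1# (- 1#) ⟩
      - 1# * - 1#     ∎

    ◃-homo : ∀ s n → ⟦ s ◃ n ⟧ℤ ≈ ⟦ s ⟧ₛ * (n × 1#)
    ◃-homo s      zero    = sym (zeroʳ _)
    ◃-homo Sign.+ (suc n) = sym (*-identityˡ _)
    ◃-homo Sign.- (suc n) = trans (-‿cong (sym (*-identityˡ _))) (-‿distribˡ-* 1# _)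

    sign-abs : ∀ i → ⟦ i ⟧ℤ ≈ ⟦ ℤ.sign i ⟧ₛ * (∣ i ∣ × 1#)
    sign-abs i = ≡.subst (λ j → ⟦ j ⟧ℤ ≈ ⟦ ℤ.sign i ⟧ₛ * (∣ i ∣ × 1#)) (ℤ.◃-inverse i) (◃-homo (ℤ.sign i) ∣ i ∣)

    ⊖-homo : ∀ m n → ⟦ m ⊖ n ⟧ℤ ≈ m × 1# - n × 1#
    ⊖-homo m       zero    = trans (sym (+-identityʳ _)) (+-congˡ (sym -0#≈0#))
    ⊖-homo zero    (suc n) = sym (+-identityˡ _)
    ⊖-homo (suc m) (suc n) rewrite ℤ.[1+m]⊖[1+n]≡m⊖n m n = begin
      ⟦ m ⊖ n ⟧ℤ                         ≈⟨ ⊖-homo m n ⟩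
      m × 1# - n × 1#                    ≈⟨ +-identityˡ _ ⟨
      0# + (m × 1# - n × 1#)             ≈⟨ +-congʳ (-‿inverseʳ 1#) ⟨
      (1# - 1#) + (m × 1# - n × 1#)      ≈⟨ +-interchange 1# (- 1#) (m × 1#) (- (n × 1#)) ⟩
      (1# + m × 1#) + (- 1# - n × 1#)    ≈⟨ +-congˡ (⁻¹-∙-comm 1# (n × 1#)) ⟩
      (1# + m × 1#) - (1# + n × 1#)      ≈⟨ +-cong (1+× m 1#) (-‿cong (1+× n 1#)) ⟨
      suc m × 1# - suc n × 1#            ∎

    +-homo : ∀ i j → ⟦ i ℤ.+ j ⟧ℤ ≈ ⟦ i ⟧ℤ + ⟦ j ⟧ℤ
    +-homo -[1+ m ] -[1+ n ] = begin
      - (suc (suc (m ℕ.+ n)) × 1#)       ≡⟨ ≡.cong (λ k → - (suc k × 1#)) (ℕ.+-suc m n) ⟨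
      - ((suc m ℕ.+ suc n) × 1#)         ≈⟨ -‿cong (×-homo-+ 1# (suc m) (suc n)) ⟩
      - (suc m × 1# + suc n × 1#)        ≈⟨ ⁻¹-∙-comm _ _ ⟨
      - (suc m × 1#) - suc n × 1#        ∎
    +-homo -[1+ m ] (+ n)    = trans (⊖-homo n (suc m)) (+-comm _ _)
    +-homo (+ m)    -[1+ n ] = ⊖-homo m (suc n)
    +-homo (+ m)    (+ n)    = ×-homo-+ 1# m n

    *-homo : ∀ i j → ⟦ i ℤ.* j ⟧ℤ ≈ ⟦ i ⟧ℤ * ⟦ j ⟧ℤ
    *-homo i j = begin
      ⟦ ℤ.sign i Sign.* ℤ.sign j ◃ ∣ i ∣ ℕ.* ∣ j ∣ ⟧ℤ
        ≈⟨ ◃-homo (ℤ.sign i Sign.* ℤ.sign j) (∣ i ∣ ℕ.* ∣ j ∣) ⟩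
      ⟦ ℤ.sign i Sign.* ℤ.sign j ⟧ₛ * ((∣ i ∣ ℕ.* ∣ j ∣) × 1#)
        ≈⟨ *-cong (⟦⟧ₛ-homo-* (ℤ.sign i) (ℤ.sign j)) (×1-homo-* ∣ i ∣ ∣ j ∣) ⟩
      (⟦ ℤ.sign i ⟧ₛ * ⟦ ℤ.sign j ⟧ₛ) * ((∣ i ∣ × 1#) * (∣ j ∣ × 1#))
        ≈⟨ *-interchange _ _ _ _ ⟩
      (⟦ ℤ.sign i ⟧ₛ * (∣ i ∣ × 1#)) * (⟦ ℤ.sign j ⟧ₛ * (∣ j ∣ × 1#))
        ≈⟨ *-cong (sign-abs i) (sign-abs j) ⟨
      ⟦ i ⟧ℤ * ⟦ j ⟧ℤ ∎

    -‿homo : ∀ i → ⟦ ℤ.- i ⟧ℤ ≈ - ⟦ i ⟧ℤ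
    -‿homo (+ zero)  = sym -0#≈0#
    -‿homo (+ suc n) = refl
    -‿homo -[1+ n ]  = sym (-‿involutive _)

  ℤ⟶R : ℤ.+-*-rawRing -Raw-AlmostCommutative⟶ fromCommutativeRing R
  ℤ⟶R = record
    { ⟦_⟧ = ⟦_⟧ℤ ; +-homo = +-homo ; *-homo = *-homo ; -‿homo = -‿homo ; 0-homo = refl ; 1-homo = refl }

  private
    ⟦⟧-≟ : ∀ i j → Maybe (⟦ i ⟧ℤ ≈ ⟦ j ⟧ℤ)
    ⟦⟧-≟ i j with i ℤ.≟ j
    ... | yes ≡.refl = just refl
    ... | no _       = nothing

  open import Algebra.Solver.Ring ℤ.+-*-rawRing (fromCommutativeRing R) ℤ⟶R ⟦⟧-≟ public

module Determinant {r ℓ : Level} (R : CommutativeRing r ℓ) where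
  open CommutativeRing R hiding (zero)
  open WithRing R
  open IntegerCoefficients R using (solve; _:=_; _:+_; _:*_; _:-_; :-_; con)
  open import Relation.Binary.Reasoning.Setoid setoid

  sumFin-cong : ∀ n {f g : Fin n → Carrier} → (∀ j → f j ≈ g j) → sumFin n f ≈ sumFin n g
  sumFin-cong zero    f≈g = refl
  sumFin-cong (suc n) f≈g = +-cong (f≈g zero) (sumFin-cong n (λ j → f≈g (suc j)))

  sumFin-zero : ∀ n {f : Fin n → Carrier} → (∀ j → f j ≈ 0#) → sumFin n f ≈ 0#
  sumFin-zero n f≈0 = trans (sumFin-cong n f≈0) (sumFin-const0 n)
    where
    sumFin-const0 : ∀ n → sumFin n (λ _ → 0#) ≈ 0#
    sumFin-const0 zero    = refl
    sumFin-const0 (suc n) = trans (+-identityˡ _) (sumFin-const0 n)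

  laplaceTerm : ∀ n → Matrix (suc n) → Fin (suc n) → Carrier
  laplaceTerm n M j = sign (toℕ j) * M zero j * det n (minor M j)

  det-cong : ∀ n {M N : Matrix n} → (∀ i j → M i j ≈ N i j) → det n M ≈ det n N
  det-cong zero    M≈N = refl
  det-cong (suc n) {M} {N} M≈N = sumFin-cong (suc n) {laplaceTerm n M} {laplaceTerm n N} λ j →
    *-cong (*-congˡ (M≈N zero j)) (det-cong n (λ r s → M≈N (suc r) (punchIn j s)))

  -- The Laplace expansion is affine in the corner entry, since no other term involves it.
  det-corner : ∀ n (M N : Matrix (suc n)) →
    (∀ j → M zero (suc j) ≈ N zero (suc j)) → (∀ i j → M (suc i) j ≈ N (suc i) j) →
    det (suc n) M ≈ det (suc n) N + (M zero zero - N zero zero) * det n (minor M zero)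
  det-corner n M N row₀ rows = begin
    1# * a * d + S                   ≈⟨ +-congˡ S≈S′ ⟩
    1# * a * d + S′                  ≈⟨ solve 4 (λ a b d S′ → con (+ 1) :* a :* d :+ S′
                                          := (con (+ 1) :* b :* d :+ S′) :+ (a :- b) :* d) refl a b d S′ ⟩
    (1# * b * d + S′) + (a - b) * d  ≈⟨ +-congʳ (+-congʳ (*-congˡ (det-cong n (λ r s → rows r (suc s))))) ⟩
    (1# * b * d′ + S′) + (a - b) * d ∎
    where
    a b d d′ S S′ : Carrier
    a = M zero zero
    b = N zero zero
    d = det n (minor M zero)
    d′ = det n (minor N zero)
    S = sumFin n (λ j → laplaceTerm n M (suc j))
    S′ = sumFin n (λ j → laplaceTerm n N (suc j))
    S≈S′ : S ≈ S′
    S≈S′ = sumFin-cong n {λ j → laplaceTerm n M (suc j)} {λ j → laplaceTerm n N (suc j)} λ j →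
      *-cong (*-congˡ (row₀ j)) (det-cong n (λ r s → rows r _))

  det-zeroBelowCorner : ∀ n (M : Matrix (suc n)) → (∀ i → M (suc i) zero ≈ 0#) →
    det (suc n) M ≈ M zero zero * det n (minor M zero)
  det-zeroBelowCorner n M col₀ = begin
    1# * M zero zero * det n (minor M zero) + sumFin n (λ j → laplaceTerm n M (suc j))
      ≈⟨ +-cong (*-assoc 1# _ _) (sumFin-zero n (λ j → trans (*-congˡ (minorVanishes n M col₀ j)) (zeroʳ _))) ⟩
    1# * (M zero zero * det n (minor M zero)) + 0#
      ≈⟨ trans (+-identityʳ _) (*-identityˡ _) ⟩
    M zero zero * det n (minor M zero) ∎
    where
    -- Deleting a column other than the first leaves a first column of zeros.
    minorVanishes : ∀ m (K : Matrix (suc m)) → (∀ i → K (suc i) zero ≈ 0#) →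
      (j : Fin m) → det m (minor K (suc j)) ≈ 0#
    minorVanishes (suc m) K colK j = begin
      det (suc m) (minor K (suc j))  ≈⟨ det-zeroBelowCorner m (minor K (suc j)) (λ i → colK (suc i)) ⟩
      K (suc zero) zero * _          ≈⟨ *-congʳ (colK zero) ⟩
      0# * _                         ≈⟨ zeroˡ _ ⟩
      0# ∎

  det-tridiagonal : ∀ n (M : Matrix (suc (suc n))) →
    (∀ j → M zero (suc (suc j)) ≈ 0#) → (∀ i → M (suc (suc i)) zero ≈ 0#) →
    det (suc (suc n)) M ≈ M zero zero * det (suc n) (minor M zero)
                          - M zero (suc zero) * M (suc zero) zero * det n (minor (minor M zero) zero)
  det-tridiagonal n M row₀ col₀ = begin
    1# * a * d₁ + (- 1# * b * det (suc n) (minor M (suc zero)) + sumFin n (λ j → laplaceTerm (suc n) M (suc (suc j))))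
      ≈⟨ +-congˡ (+-cong (*-congˡ (det-zeroBelowCorner n (minor M (suc zero)) col₀))
                          (sumFin-zero n (λ j → trans (*-congʳ (*-congˡ (row₀ j))) (trans (*-congʳ (zeroʳ _)) (zeroˡ _))))) ⟩
    1# * a * d₁ + (- 1# * b * (c * d₀) + 0#)
      ≈⟨ solve 5 (λ a b c d₁ d₀ → con (+ 1) :* a :* d₁ :+ (:- con (+ 1) :* b :* (c :* d₀) :+ con (+ 0))
                                  := a :* d₁ :- b :* c :* d₀) refl a b c d₁ d₀ ⟩
    a * d₁ - b * c * d₀ ∎
    where
    a b c d₁ d₀ : Carrier
    a = M zero zero
    b = M zero (suc zero)
    c = M (suc zero) zero
    d₁ = det (suc n) (minor M zero)
    d₀ = det n (minor (minor M zero) zero)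

module PathCharacteristicPolynomials {r ℓ : Level} (R : CommutativeRing r ℓ) (α x : CommutativeRing.Carrier R) where
  open CommutativeRing R hiding (zero)
  open WithRing R
  open Determinant R
  open IntegerCoefficients R using (solve; _:=_; _:+_; _:*_; _:-_; con)
  open import Relation.Binary.Reasoning.Setoid setoid

  charMat : ∀ n → Matrix n → Matrix n
  charMat n M i j = x * idMat n i j - M i j

  -- Vertex u₁ is adjacent to u₂ only, so deleting it changes no row of a later vertex.
  Aα-dropFirst : ∀ m i j → Aα α (suc (suc m)) (suc (suc i)) (suc j) ≈ Aα α (suc m) (suc i) j
  Aα-dropFirst m i j = +-congʳ (*-congˡ (if-0#+ (toℕ (suc i) ≡ᵇ toℕ j)))
    where
    if-0#+ : ∀ b {y} → (if b then 0# + y else 0#) ≈ (if b then y else 0#)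
    if-0#+ true  = +-identityˡ _
    if-0#+ false = refl

  charMat-B-minor : ∀ n r s → minor (charMat (suc n) (B α (suc n))) zero r s ≈ charMat n (B α n) r s
  charMat-B-minor n r s = +-congˡ (-‿cong (Aα-dropFirst n r (suc s)))

  φP-one : ∀ β → φP α β 1 x ≈ x
  φP-one β = solve 3 (λ x α d → con (+ 1) :* (x :* con (+ 1) :- (α :* (con (+ 0) :+ con (+ 0)) :+ d :* con (+ 0))) :* con (+ 1) :+ con (+ 0)
                                 := x) refl x α (1# - α)

  φP-suc : ∀ β n → φP α β (suc n) x ≈ φB α (suc n) x + α * φB α n x
  φP-suc β n = begin
    det (suc n) P
      ≈⟨ det-corner n P Q (λ j → refl) (λ i j → +-congˡ (-‿cong (sym (Aα-dropFirst n i j)))) ⟩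
    det (suc n) Q + (P zero zero - Q zero zero) * φB α n x
      ≈⟨ +-congˡ (*-congʳ cornerDifference) ⟩
    φB α (suc n) x + α * φB α n x ∎
    where
    P Q : Matrix (suc n)
    P = charMat (suc n) (Aα α (suc n))
    Q = charMat (suc n) (B α (suc n))
    cornerDifference : P zero zero - Q zero zero ≈ α
    cornerDifference = solve 4 (λ x α c d → (x :* con (+ 1) :- (α :* d :+ c :* con (+ 0)))
                                              :- (x :* con (+ 1) :- (α :* (con (+ 1) :+ d) :+ c :* con (+ 0)))
                                            := α) refl x α (1# - α) (sumFin (suc n) (A (suc n) zero))

  φB-recurrence : ∀ n → φB α (suc (suc n)) x ≈ (x - (α + α)) * φB α (suc n) x - (1# - α) * (1# - α) * φB α n x
  φB-recurrence n = begin
    det (suc (suc n)) M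
      ≈⟨ det-tridiagonal n M (λ _ → offBand) (λ _ → offBand) ⟩
    M zero zero * det (suc n) (minor M zero) - M zero (suc zero) * M (suc zero) zero * det n (minor (minor M zero) zero)
      ≈⟨ +-cong (*-cong diagonal (det-cong (suc n) (charMat-B-minor (suc n))))
                (-‿cong (*-cong offDiagonal (det-cong n λ r s → trans (charMat-B-minor (suc n) (suc r) (suc s)) (charMat-B-minor n r s)))) ⟩
    (x - (α + α)) * φB α (suc n) x - (1# - α) * (1# - α) * φB α n x ∎
    where
    M : Matrix (suc (suc n))
    M = charMat (suc (suc n)) (B α (suc (suc n)))
    offBand : x * 0# - (α * 0# + (1# - α) * 0#) ≈ 0#
    offBand = solve 3 (λ x α c → x :* con (+ 0) :- (α :* con (+ 0) :+ c :* con (+ 0)) := con (+ 0)) refl x α (1# - α)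
    -- u₂ has degree 2: its neighbours u₁ and u₃.
    diagonal : M zero zero ≈ x - (α + α)
    diagonal = begin
      x * 1# - (α * (1# + (0# + (1# + S))) + (1# - α) * 0#) ≈⟨ +-congˡ (-‿cong (+-congʳ (*-congˡ (+-congˡ (+-congˡ (+-congˡ S≈0)))))) ⟩
      x * 1# - (α * (1# + (0# + (1# + 0#))) + (1# - α) * 0#)
        ≈⟨ solve 3 (λ x α c → x :* con (+ 1) :- (α :* (con (+ 1) :+ (con (+ 0) :+ (con (+ 1) :+ con (+ 0)))) :+ c :* con (+ 0))
                               := x :- (α :+ α)) refl x α (1# - α) ⟩
      x - (α + α) ∎
      where
      S : Carrier
      S = sumFin n (λ k → A (suc (suc (suc n))) (suc zero) (suc (suc (suc k))))
      S≈0 : S ≈ 0#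
      S≈0 = sumFin-zero n (λ _ → refl)
    offDiagonal : M zero (suc zero) * M (suc zero) zero ≈ (1# - α) * (1# - α)
    offDiagonal = solve 3 (λ x α c → (x :* con (+ 0) :- (α :* con (+ 0) :+ c :* con (+ 1)))
                                     :* (x :* con (+ 0) :- (α :* con (+ 0) :+ c :* con (+ 1))) := c :* c) refl x α (1# - α)

  φP₀-weight : ∀ {t β} → α * t ≈ 1# → (1# - α) * β ≈ 1# →
    (1# - α) * (1# - α) * t * φP α β 0 x ≈ t - (1# + 1#)
  φP₀-weight {t} {β} αt≈1 cβ≈1 = begin
    (1# - α) * (1# - α) * t * ((1# - (α + α)) * (β * β))
      ≈⟨ solve 3 (λ α t β → (con (+ 1) :- α) :* (con (+ 1) :- α) :* t :* ((con (+ 1) :- (α :+ α)) :* (β :* β))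
                           := ((con (+ 1) :- α) :* β) :* ((con (+ 1) :- α) :* β) :* (t :- (con (+ 1) :+ con (+ 1)) :* (α :* t)))
                 refl α t β ⟩
    ((1# - α) * β) * ((1# - α) * β) * (t - (1# + 1#) * (α * t))
      ≈⟨ *-cong (*-cong cβ≈1 cβ≈1) (+-congˡ (-‿cong (*-congˡ αt≈1))) ⟩
    1# * 1# * (t - (1# + 1#) * 1#)
      ≈⟨ solve 1 (λ t → con (+ 1) :* con (+ 1) :* (t :- (con (+ 1) :+ con (+ 1)) :* con (+ 1))
                        := t :- (con (+ 1) :+ con (+ 1))) refl t ⟩
    t - (1# + 1#) ∎

  -- The relation α t ≈ 1 is used by writing the difference of the two sides as a multiple of α t - 1.
  recurrence-combination : ∀ {t} → α * t ≈ 1# → ∀ E₁ E₀ →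
    (((x - (α + α)) * E₁ - (1# - α) * (1# - α) * E₀) + α * E₁) + (1# - α) * (1# - α) * t * (E₁ + α * E₀)
      ≈ (x + t - (1# + 1#)) * E₁
  recurrence-combination {t} αt≈1 E₁ E₀ = begin
    (((x - (α + α)) * E₁ - (1# - α) * (1# - α) * E₀) + α * E₁) + (1# - α) * (1# - α) * t * (E₁ + α * E₀)
      ≈⟨ solve 5 (λ x α t E₁ E₀ →
            (((x :- (α :+ α)) :* E₁ :- (con (+ 1) :- α) :* (con (+ 1) :- α) :* E₀) :+ α :* E₁)
              :+ (con (+ 1) :- α) :* (con (+ 1) :- α) :* t :* (E₁ :+ α :* E₀)
            := (x :+ t :- (con (+ 1) :+ con (+ 1))) :* E₁
              :+ (α :* t :- con (+ 1)) :* ((α :- (con (+ 1) :+ con (+ 1))) :* E₁ :+ (con (+ 1) :- α) :* (con (+ 1) :- α) :* E₀))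
            refl x α t E₁ E₀ ⟩
    (x + t - (1# + 1#)) * E₁ + (α * t - 1#) * K  ≈⟨ +-congˡ (*-congʳ (+-congʳ αt≈1)) ⟩
    (x + t - (1# + 1#)) * E₁ + (1# - 1#) * K     ≈⟨ +-congˡ (trans (*-congʳ (-‿inverseʳ 1#)) (zeroˡ K)) ⟩
    (x + t - (1# + 1#)) * E₁ + 0#                ≈⟨ +-identityʳ _ ⟩
    (x + t - (1# + 1#)) * E₁ ∎
    where
    K : Carrier
    K = (α - (1# + 1#)) * E₁ + (1# - α) * (1# - α) * E₀

mainTheorem5 : {c ℓ : Level} (R : CommutativeRing c ℓ) →
    let open CommutativeRing R
        open WithRing R
    in (α α⁻¹ β : Carrier) → α * α⁻¹ ≈ 1# → (1# + - α) * β ≈ 1# →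
       (x : Carrier) (n : ℕ) →
       (x + α⁻¹ + - (1# + 1#)) * φB α n x
         ≈ φP α β (suc n) x + ((1# + - α) * (1# + - α) * α⁻¹) * φP α β n x
mainTheorem5 R α t β αt≈1 cβ≈1 x zero = begin
  (x + t - (1# + 1#)) * 1#                            ≈⟨ trans (*-identityʳ _) (+-assoc x t _) ⟩
  x + (t - (1# + 1#))                                 ≈⟨ +-cong (φP-one β) (φP₀-weight αt≈1 cβ≈1) ⟨
  φP α β 1 x + (1# - α) * (1# - α) * t * φP α β 0 x ∎
  where
  open CommutativeRing R hiding (zero)
  open WithRing R
  open PathCharacteristicPolynomials R α x
  open import Relation.Binary.Reasoning.Setoid setoid
mainTheorem5 R α t β αt≈1 cβ≈1 x (suc m) = begin
  (x + t - (1# + 1#)) * E₁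
    ≈⟨ recurrence-combination αt≈1 E₁ E₀ ⟨
  (((x - (α + α)) * E₁ - (1# - α) * (1# - α) * E₀) + α * E₁) + κ * (E₁ + α * E₀)
    ≈⟨ +-congʳ (+-congʳ (φB-recurrence m)) ⟨
  (φB α (suc (suc m)) x + α * E₁) + κ * (E₁ + α * E₀)
    ≈⟨ +-cong (φP-suc β (suc m)) (*-congˡ (φP-suc β m)) ⟨
  φP α β (suc (suc m)) x + κ * φP α β (suc m) x ∎
  where
  open CommutativeRing R hiding (zero)
  open WithRing R
  open PathCharacteristicPolynomials R α x
  open import Relation.Binary.Reasoning.Setoid setoid
  κ E₁ E₀ : Carrier
  κ = (1# - α) * (1# - α) * t
  E₁ = φB α (suc m) x
  E₀ = φB α m x
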